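{- Let $G$ be a connected graph. Then $\mathrm{vv}(G)$ is equal to the largest possible number of leaves of a shortest-path tree of $G$, where the maximum is taken over all shortest-path trees of $G$ rooted at any vertex of $G$.
   Context: All graphs are finite and simple. For a vertex $x$ of a connected graph $G$, a set $S\subseteq V(G)\setminus\{x\}$ is an $x$-visibility set if for every $y\in S$ there exists a shortest $x,y$-path $P$ in $G$ with $V(P)\cap S=\{y\}$. The $x$-visibility number $v_x(G)$ is the maximum cardinality of an $x$-visibility set, and $\mathrm{vv}(G)=\max_{x\in V(G)} v_x(G)$. A shortest-path tree of $G$ rooted at $x\in V(G)$ is a spanning tree $T$ of $G$ such that $d_T(x,y)=d_G(x,y)$ for every $y\in V(G)$ (e.g. a BFS tree from $x$); its leaves are the non-root vertices of $T$ having no children, i.e. non-root vertices of degree $1$ in $T$. -}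

module Defs where

open import Data.Nat using (ℕ; zero; suc; _≤_; _≡ᵇ_)
open import Data.Bool using (Bool; true; false; not; _∧_)
open import Data.Fin using (Fin)
open import Data.Fin.Properties using (_≟_)
open import Data.Fin.Subset using (Subset; _∈_; _∉_; ∣_∣)
open import Data.List using (List; []; _∷_; length; filterᵇ; allFin)
open import Data.List.Relation.Unary.Unique.Propositional using (Unique)
open import Data.Product using (Σ; ∃; _×_; _,_)
open import Relation.Nullary using (¬_)
open import Data.Empty using (⊥)
open import Data.List.Membership.Propositional using () renaming (_∈_ to _∈ₗ_)
open import Relation.Nullary.Decidable using (⌊_⌋)
open import Relation.Binary.PropositionalEquality using (_≡_)

record Graph (n : ℕ) : Set where
  field
    adj    : Fin n → Fin n → Bool
    sym    : ∀ u v → adj u v ≡ adj v u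
    irrefl : ∀ u → adj u u ≡ false
open Graph public

module _ {n : ℕ} (G : Graph n) where

  data Walk : Fin n → Fin n → Set where
    stop : ∀ x → Walk x x
    step : ∀ {y z} x → adj G x y ≡ true → Walk y z → Walk x z

  len : ∀ {x y} → Walk x y → ℕ
  len (stop _)     = 0
  len (step _ _ p) = suc (len p)

  verts : ∀ {x y} → Walk x y → List (Fin n)
  verts (stop x)     = x ∷ []
  verts (step x _ p) = x ∷ verts p

  IsPath : ∀ {x y} → Walk x y → Set
  IsPath p = Unique (verts p)

  IsShortest : ∀ {x y} → Walk x y → Set
  IsShortest {x} {y} p = IsPath p × (∀ (q : Walk x y) → len p ≤ len q)

  IsDist : Fin n → Fin n → ℕ → Set
  IsDist x y k = (Σ (Walk x y) λ p → len p ≡ k) × (∀ (q : Walk x y) → k ≤ len q)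

  Connected : Set
  Connected = ∀ x y → Walk x y

  -- a cycle: distinct vertices v0,...,vk (k ≥ 2), consecutive ones adjacent,
  -- and vk adjacent to v0
  data ChainFrom : Fin n → List (Fin n) → Set where
    one  : ∀ v → ChainFrom v (v ∷ [])
    more : ∀ {w vs} v → adj G v w ≡ true → ChainFrom w (w ∷ vs) → ChainFrom v (v ∷ w ∷ vs)

  lastOf : Fin n → List (Fin n) → Fin n
  lastOf v []       = v
  lastOf v (w ∷ ws) = lastOf w ws

  IsCycle : List (Fin n) → Set
  IsCycle []                 = ⊥
  IsCycle (v ∷ [])           = ⊥
  IsCycle (v ∷ w ∷ [])       = ⊥
  IsCycle (v ∷ w ∷ u ∷ vs)   =
    Unique (v ∷ w ∷ u ∷ vs) × ChainFrom v (v ∷ w ∷ u ∷ vs)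
      × (adj G (lastOf v (w ∷ u ∷ vs)) v ≡ true)

  Acyclic : Set
  Acyclic = ∀ (c : List (Fin n)) → ¬ IsCycle c

  IsTree : Set
  IsTree = Connected × Acyclic

  deg : Fin n → ℕ
  deg u = length (filterᵇ (λ v → adj G u v) (allFin n))

  -- number of leaves of G viewed as a tree rooted at r:
  -- non-root vertices of degree 1
  leavesFrom : Fin n → ℕ
  leavesFrom r = length (filterᵇ (λ u → not ⌊ r ≟ u ⌋ ∧ (deg u ≡ᵇ 1)) (allFin n))

  IsVisibilitySet : Fin n → Subset n → Set
  IsVisibilitySet x S =
    x ∉ S ×
    (∀ y → y ∈ S → Σ (Walk x y) λ p → IsShortest p ×
        (∀ z → z ∈ₗ verts p → z ∈ S → z ≡ y))

  IsVV : ℕ → Set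
  IsVV k = (∃ λ x → Σ (Subset n) λ S → IsVisibilitySet x S × ∣ S ∣ ≡ k)
         × (∀ x (S : Subset n) → IsVisibilitySet x S → ∣ S ∣ ≤ k)

SpanningSubgraph : ∀ {n} → Graph n → Graph n → Set
SpanningSubgraph {n} T G = ∀ (u v : Fin n) → adj T u v ≡ true → adj G u v ≡ true

IsShortestPathTree : ∀ {n} → Graph n → Fin n → Graph n → Set
IsShortestPathTree {n} G x T =
  SpanningSubgraph T G × IsTree T ×
  (∀ (y : Fin n) → ∃ λ k → IsDist T x y k × IsDist G x y k)

IsMaxSPTLeaves : ∀ {n} → Graph n → ℕ → Set
IsMaxSPTLeaves {n} G k =
  (∃ λ x → Σ (Graph n) λ T → IsShortestPathTree G x T × leavesFrom T x ≡ k)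
  × (∀ x (T : Graph n) → IsShortestPathTree G x T → leavesFrom T x ≤ k)

{-# OPTIONS --safe #-}
-- The leaves of a shortest-path tree rooted at x form an x-visibility set: the tree path to a
-- leaf is a shortest path, and each of its inner vertices has tree degree at least 2.
-- Conversely, given an x-visibility set S, call a vertex clear if some geodesic from x to it
-- meets S at most in its last vertex, and take a BFS tree in which every vertex having a clear
-- neighbour one level closer to x takes such a neighbour as its parent. The vertices of S are
-- clear, and the proper ancestors of a clear vertex are clear and outside S, so no vertex of S
-- lies above another: sending each vertex of S to a leaf below it is injective. Both numbers
-- are therefore the largest leaf count among these finitely many trees.
module Submission where

open import Defs hiding (sym)
open import Data.Bool using (Bool; true; false; not; _∧_)
import Data.Bool.Properties as Bool
open import Data.Bool.Properties using (∨-comm; ∧-conicalˡ; ∧-conicalʳ; T-≡)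
open import Data.Empty using (⊥-elim)
open import Data.Fin using (Fin; zero; suc; toℕ)
open import Data.Fin.Properties using (_≟_; any?; pigeonhole; toℕ≤pred[n])
open import Data.Fin.Subset using (Subset; ⊥; inside; outside; _∈_; _∉_; _⊆_; _⊂_; ∣_∣; ⁅_⁆; _-_)
open import Data.Fin.Subset.Induction using (Acc; acc; ⊂-wellFounded)
open import Data.Fin.Subset.Properties using (_∈?_; anySubset?; ∣p∣≤n; x∈⁅x⁆; ∣⁅x⁆∣≡1; ∣⊥∣≡0; p⊆q⇒∣p∣≤∣q∣; p─⊥≡p; p─q⊆p; x∈p∧x≢y⇒x∈p-y; x∈p⇒p-x⊂p; nonempty?; Empty-unique)
open import Data.List using (List; []; _∷_; length; filterᵇ)
open import Data.List.Membership.Propositional using () renaming (_∈_ to _∈ₗ_)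
open import Data.List.Relation.Unary.All as All using (All; []; _∷_)
open import Data.List.Relation.Unary.AllPairs using ([]; _∷_)
open import Data.List.Relation.Unary.Any using (here; there)
open import Data.List.Relation.Unary.Unique.Propositional using (Unique)
import Data.List as List
open import Data.Nat using (ℕ; zero; suc; _+_; _∸_; _≤_; _≤?_; _<_; z≤n; s≤s; _≡ᵇ_)
open import Data.Nat.Properties using (≤-refl; ≤-reflexive; ≤-antisym; ≤-trans; ≤-pred; <-irrefl; <-trans; <-asym; <⇒≤; ≤⇒≯; ≰⇒>; ≤-total; n≤1+n; m≤n+m; m∸n+n≡m; +-identityʳ; +-cancelˡ-≡; n<1+n; suc-injective; +-cancelʳ-≤; ≮⇒≥; n≤0⇒n≡0; ≡ᵇ⇒≡; m≤m+n; +-suc; +-monoˡ-≤; anyUpTo?; module ≤-Reasoning)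
import Data.Nat as ℕ
open import Data.Nat.Induction using (<-rec)
open import Data.Nat.GeneralisedArithmetic using (fold; fold-+)
open import Data.Product using (Σ; ∃; _×_; _,_; proj₁; proj₂)
open import Data.Sum using (_⊎_; inj₁; inj₂; [_,_])
open import Data.Vec using (tabulate; _∷_)
open import Data.Vec.Base using (here; there)
open import Data.Vec.Properties using (lookup∘tabulate; []=⇒lookup; lookup⇒[]=)
open import Function using (_∘_; id; case_of_; Equivalence)
open import Relation.Binary.PropositionalEquality using (_≡_; _≢_; refl; sym; trans; cong; cong₂; subst; subst₂; module ≡-Reasoning)
open import Relation.Nullary using (Dec; does; yes; no; ¬_)
open import Relation.Nullary.Decidable using (⌊_⌋; map′; ¬?; _⊎-dec_; _×-dec_; dec-true; dec-false; isYes≗does)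
open import Relation.Unary using (Decidable)

does≡true⇒ : ∀ {A : Set} (a? : Dec A) → does a? ≡ true → A
does≡true⇒ (yes a) _  = a
does≡true⇒ (no _)  ()

∈-tabulate⁺ : ∀ {N} (f : Fin N → Bool) {i} → f i ≡ true → i ∈ tabulate f
∈-tabulate⁺ f {i} fi = lookup⇒[]= i (tabulate f) (trans (lookup∘tabulate f i) fi)

∈-tabulate⁻ : ∀ {N} (f : Fin N → Bool) {i} → i ∈ tabulate f → f i ≡ true
∈-tabulate⁻ f {i} i∈f = trans (sym (lookup∘tabulate f i)) ([]=⇒lookup i∈f)

length-filterᵇ-tabulate : ∀ {M N} (f : Fin M → Bool) (g : Fin N → Fin M) →
  length (filterᵇ f (List.tabulate g)) ≡ ∣ tabulate (f ∘ g) ∣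
length-filterᵇ-tabulate {N = zero}  f g = refl
length-filterᵇ-tabulate {N = suc N} f g with f (g zero)
... | true  = cong suc (length-filterᵇ-tabulate f (g ∘ suc))
... | false = length-filterᵇ-tabulate f (g ∘ suc)

x∉p-x : ∀ {N} (p : Subset N) x → x ∉ p - x
x∉p-x (inside  ∷ p) zero    ()
x∉p-x (outside ∷ p) zero    ()
x∉p-x (b       ∷ p) (suc x) (there x∈p-x) = x∉p-x p x x∈p-x

∣p∣≡1+∣p-x∣ : ∀ {N} (p : Subset N) {x} → x ∈ p → ∣ p ∣ ≡ suc ∣ p - x ∣
∣p∣≡1+∣p-x∣ (inside  ∷ p) here        = cong suc (sym (cong ∣_∣ (p─⊥≡p p)))
∣p∣≡1+∣p-x∣ (inside  ∷ p) (there x∈p) = cong suc (∣p∣≡1+∣p-x∣ p x∈p)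
∣p∣≡1+∣p-x∣ (outside ∷ p) (there x∈p) = ∣p∣≡1+∣p-x∣ p x∈p

x∈p⇒1≤∣p∣ : ∀ {N} {p : Subset N} {x} → x ∈ p → 1 ≤ ∣ p ∣
x∈p⇒1≤∣p∣ {p = p} x∈p rewrite ∣p∣≡1+∣p-x∣ p x∈p = s≤s z≤n

x∈p∧y∈p∧x≢y⇒2≤∣p∣ : ∀ {N} {p : Subset N} {x y} → x ∈ p → y ∈ p → x ≢ y → 2 ≤ ∣ p ∣
x∈p∧y∈p∧x≢y⇒2≤∣p∣ {p = p} x∈p y∈p x≢y rewrite ∣p∣≡1+∣p-x∣ p x∈p =
  s≤s (x∈p⇒1≤∣p∣ (x∈p∧x≢y⇒x∈p-y y∈p (x≢y ∘ sym)))

x∈p∧p⊆⁅x⁆⇒∣p∣≡1 : ∀ {N} {p : Subset N} {x} → x ∈ p → p ⊆ ⁅ x ⁆ → ∣ p ∣ ≡ 1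
x∈p∧p⊆⁅x⁆⇒∣p∣≡1 {x = x} x∈p p⊆⁅x⁆ =
  ≤-antisym (subst (_ ≤_) (∣⁅x⁆∣≡1 x) (p⊆q⇒∣p∣≤∣q∣ p⊆⁅x⁆)) (x∈p⇒1≤∣p∣ x∈p)

module _ {M N} (f : Fin N → Fin M) where

  injectiveOn⇒∣p∣≤∣q∣ : ∀ {p : Subset N} {q : Subset M} → (∀ {x} → x ∈ p → f x ∈ q) →
    (∀ {x y} → x ∈ p → y ∈ p → f x ≡ f y → x ≡ y) → ∣ p ∣ ≤ ∣ q ∣
  injectiveOn⇒∣p∣≤∣q∣ {p} = go p (⊂-wellFounded p)
    where
    go : ∀ p {q} → Acc _⊂_ p → (∀ {x} → x ∈ p → f x ∈ q) →
      (∀ {x y} → x ∈ p → y ∈ p → f x ≡ f y → x ≡ y) → ∣ p ∣ ≤ ∣ q ∣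
    go p {q} (acc rec) into inj with nonempty? p
    ... | no p-empty = subst (_≤ ∣ q ∣) (sym (trans (cong ∣_∣ (Empty-unique p-empty)) (∣⊥∣≡0 N))) z≤n
    ... | yes (x , x∈p) rewrite ∣p∣≡1+∣p-x∣ p x∈p | ∣p∣≡1+∣p-x∣ q (into x∈p) =
      s≤s (go (p - x) (rec (x∈p⇒p-x⊂p x∈p)) into′ inj′)
      where
      p-x⊆p : p - x ⊆ p
      p-x⊆p = p─q⊆p p ⁅ x ⁆
      into′ : ∀ {y} → y ∈ p - x → f y ∈ q - f x
      into′ {y} y∈p-x = x∈p∧x≢y⇒x∈p-y (into (p-x⊆p y∈p-x))
        λ fy≡fx → x∉p-x p x (subst (_∈ p - x) (inj (p-x⊆p y∈p-x) x∈p fy≡fx) y∈p-x)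
      inj′ : ∀ {y z} → y ∈ p - x → z ∈ p - x → f y ≡ f z → y ≡ z
      inj′ y∈ z∈ = inj (p-x⊆p y∈) (p-x⊆p z∈)

IsLeast : (ℕ → Set) → ℕ → Set
IsLeast P m = P m × (∀ {j} → P j → m ≤ j)

least : ∀ {P : ℕ → Set} → Decidable P → ∀ {k} → P k → ∃ (IsLeast P)
least {P} P? {k} = <-rec (λ k → P k → ∃ (IsLeast P)) search k
  where
  search : ∀ k → (∀ {j} → j < k → P j → ∃ (IsLeast P)) → P k → ∃ (IsLeast P)
  search k rec pk with anyUpTo? P? k
  ... | yes (j , j<k , pj) = rec j<k pj
  ... | no none            = k , pk , λ {j} pj → ≮⇒≥ λ j<k → none (j , j<k , pj)

maximum-attained : ∀ {A : Set} (f : A → ℕ) → (∀ m → Dec (∃ λ a → m ≤ f a)) →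
  ∀ {B} → (∀ a → f a ≤ B) → A → ∃ λ a → ∀ b → f b ≤ f a
maximum-attained f ≤f? {zero}  f≤B a₀ = a₀ , λ b → ≤-trans (f≤B b) z≤n
maximum-attained f ≤f? {suc B} f≤B a₀ with ≤f? (suc B)
... | yes (a , B<fa) = a , λ b → ≤-trans (f≤B b) B<fa
... | no none        = maximum-attained f ≤f? (λ a → ≮⇒≥ λ B<fa → none (a , B<fa)) a₀

module _ {N} {H : Graph N} where

  _▷_ : ∀ {a b c} → Walk H a b → adj H b c ≡ true → Walk H a c
  stop a     ▷ e = step a e (stop _)
  step a f p ▷ e = step a f (p ▷ e)

  len-▷ : ∀ {a b c} (p : Walk H a b) (e : adj H b c ≡ true) → len H (p ▷ e) ≡ suc (len H p)
  len-▷ (stop a)     e = refl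
  len-▷ (step a f p) e = cong suc (len-▷ p e)

  reverse : ∀ {a b} → Walk H a b → Walk H b a
  reverse (stop a)         = stop a
  reverse (step {y} a e p) = reverse p ▷ trans (Graph.sym H y a) e

  len-reverse : ∀ {a b} (p : Walk H a b) → len H (reverse p) ≡ len H p
  len-reverse (stop a)     = refl
  len-reverse (step a e p) = trans (len-▷ (reverse p) _) (cong suc (len-reverse p))

  _++_ : ∀ {a b c} → Walk H a b → Walk H b c → Walk H a c
  stop a     ++ q = q
  step a e p ++ q = step a e (p ++ q)

  head∈verts : ∀ {a b} (p : Walk H a b) → a ∈ₗ verts H p
  head∈verts (stop a)     = here refl
  head∈verts (step a e p) = here refl

module _ {N} (H : Graph N) where

  deg≡∣neighbours∣ : ∀ v → deg H v ≡ ∣ tabulate (adj H v) ∣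
  deg≡∣neighbours∣ v = length-filterᵇ-tabulate (adj H v) id

  unique-neighbour⇒deg≡1 : ∀ {v w} → adj H v w ≡ true → (∀ u → adj H v u ≡ true → u ≡ w) →
    deg H v ≡ 1
  unique-neighbour⇒deg≡1 {v} vw only-w = trans (deg≡∣neighbours∣ v)
    (x∈p∧p⊆⁅x⁆⇒∣p∣≡1 (∈-tabulate⁺ (adj H v) vw)
      λ {u} u∈ → subst (_∈ ⁅ _ ⁆) (sym (only-w u (∈-tabulate⁻ (adj H v) u∈))) (x∈⁅x⁆ _))

  two-neighbours⇒2≤deg : ∀ {v u w} → u ≢ w → adj H v u ≡ true → adj H v w ≡ true → 2 ≤ deg H v
  two-neighbours⇒2≤deg {v} u≢w vu vw = subst (2 ≤_) (sym (deg≡∣neighbours∣ v))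
    (x∈p∧y∈p∧x≢y⇒2≤∣p∣ (∈-tabulate⁺ (adj H v) vu) (∈-tabulate⁺ (adj H v) vw) u≢w)

  private
    2≤deg-after : ∀ {a c b} → adj H a c ≡ true → (q : Walk H c b) → All (a ≢_) (verts H q) →
      Unique (verts H q) → ∀ {z} → z ∈ₗ verts H q → z ≢ b → 2 ≤ deg H z
    2≤deg-after ac (stop c)       _           _        (here refl) z≢b = ⊥-elim (z≢b refl)
    2≤deg-after ac (step c ce q)  (a≢c ∷ a∉q) _        (here refl) _   =
      two-neighbours⇒2≤deg (All.lookup a∉q (head∈verts q)) (trans (Graph.sym H c _) ac) ce
    2≤deg-after ac (step c ce q)  _           (c∉q ∷ uq) (there z∈q) z≢b =
      2≤deg-after ce q c∉q uq z∈q z≢b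

  inner-vertex⇒2≤deg : ∀ {a b} (p : Walk H a b) → Unique (verts H p) →
    ∀ {z} → z ∈ₗ verts H p → z ≢ a → z ≢ b → 2 ≤ deg H z
  inner-vertex⇒2≤deg (stop a)     _          (here refl) z≢a _   = ⊥-elim (z≢a refl)
  inner-vertex⇒2≤deg (step a e q) _          (here refl) z≢a _   = ⊥-elim (z≢a refl)
  inner-vertex⇒2≤deg (step a e q) (a∉q ∷ uq) (there z∈q) _   z≢b = 2≤deg-after e q a∉q uq z∈q z≢b

module _ {N} {T G : Graph N} (T⊆G : SpanningSubgraph T G) where

  liftWalk : ∀ {a b} → Walk T a b → Walk G a b
  liftWalk (stop a)         = stop a
  liftWalk (step {y} a e p) = step a (T⊆G a y e) (liftWalk p)

  len-liftWalk : ∀ {a b} (p : Walk T a b) → len G (liftWalk p) ≡ len T p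
  len-liftWalk (stop a)     = refl
  len-liftWalk (step a e p) = cong suc (len-liftWalk p)

  verts-liftWalk : ∀ {a b} (p : Walk T a b) → verts G (liftWalk p) ≡ verts T p
  verts-liftWalk (stop a)     = refl
  verts-liftWalk (step a e p) = cong (a ∷_) (verts-liftWalk p)

module Distance {N} (G : Graph N) (connected : Connected G) (r : Fin N) where

  -- A decidable rendering of "some walk from v to r has at most j edges"; d v is the least such j.
  Reach : ℕ → Fin N → Set
  Reach zero    v = v ≡ r
  Reach (suc j) v = v ≡ r ⊎ ∃ λ u → adj G v u ≡ true × Reach j u

  reach? : ∀ j v → Dec (Reach j v)
  reach? zero    v = v ≟ r
  reach? (suc j) v = v ≟ r ⊎-dec any? λ u → (adj G v u Bool.≟ true) ×-dec reach? j u

  walk⇒reach : ∀ {v} (p : Walk G v r) → Reach (len G p) v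
  walk⇒reach (stop _)     = refl
  walk⇒reach (step v e p) = inj₂ (_ , e , walk⇒reach p)

  reach⇒walk : ∀ j {v} → Reach j v → Σ (Walk G v r) λ p → len G p ≤ j
  reach⇒walk zero    refl                = stop r , z≤n
  reach⇒walk (suc j) (inj₁ refl)         = stop r , z≤n
  reach⇒walk (suc j) (inj₂ (u , e , ru)) with reach⇒walk j ru
  ... | p , p≤j = step _ e p , s≤s p≤j

  opaque
    d : Fin N → ℕ
    d v = proj₁ (least (λ j → reach? j v) (walk⇒reach (connected v r)))

    d-reach : ∀ v → Reach (d v) v
    d-reach v = proj₁ (proj₂ (least (λ j → reach? j v) (walk⇒reach (connected v r))))

    d-least : ∀ {j v} → Reach j v → d v ≤ j
    d-least {v = v} = proj₂ (proj₂ (least (λ j → reach? j v) (walk⇒reach (connected v r))))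

  d-root : d r ≡ 0
  d-root = n≤0⇒n≡0 (d-least {0} refl)

  d≡0⇒root : ∀ {v} → d v ≡ 0 → v ≡ r
  d≡0⇒root {v} d≡0 = subst (λ j → Reach j v) d≡0 (d-reach v)

  d-adj : ∀ {a c} → adj G a c ≡ true → d c ≤ suc (d a)
  d-adj {a} {c} e = d-least (inj₂ (a , trans (Graph.sym G c a) e , d-reach a))

  d-walk : ∀ {a b} (p : Walk G a b) → d b ≤ d a + len G p
  d-walk {a} (stop _)     = m≤m+n (d a) 0
  d-walk {a} (step _ e q) = begin
    d _                   ≤⟨ d-walk q ⟩
    d _ + len G q         ≤⟨ +-monoˡ-≤ (len G q) (d-adj e) ⟩
    suc (d a) + len G q   ≡⟨ +-suc (d a) (len G q) ⟨
    d a + suc (len G q)   ∎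
    where open ≤-Reasoning

  d≤len : ∀ {v} (p : Walk G r v) → d v ≤ len G p
  d≤len {v} p = subst (λ m → d v ≤ m + len G p) d-root (d-walk p)

  shortest-walk : ∀ v → Σ (Walk G r v) λ p → len G p ≡ d v
  shortest-walk v with reach⇒walk (d v) (d-reach v)
  ... | p , p≤d = reverse p , ≤-antisym (subst (_≤ d v) (sym (len-reverse p)) p≤d) (d≤len (reverse p))

  isDist : ∀ v → IsDist G r v (d v)
  isDist v = shortest-walk v , d≤len

  parent : ∀ {v} → v ≢ r → ∃ λ u → adj G v u ≡ true × suc (d u) ≡ d v
  parent {v} v≢r = go (d v) refl (d-reach v)
    where
    go : ∀ j → j ≡ d v → Reach j v → ∃ λ u → adj G v u ≡ true × suc (d u) ≡ d v
    go zero    _   v≡r                = ⊥-elim (v≢r v≡r)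
    go (suc j) _   (inj₁ v≡r)         = ⊥-elim (v≢r v≡r)
    go (suc j) j≡d (inj₂ (u , e , ru)) = u , e , trans (cong suc (≤-antisym (d-least ru) j≤du)) j≡d
      where
      j≤du : j ≤ d u
      j≤du = ≤-pred (subst (_≤ suc (d u)) (sym j≡d) (d-adj (trans (Graph.sym G u v) e)))

  Tight : ∀ {a b} → Walk G a b → Set
  Tight {a} {b} p = d b ≡ d a + len G p

  tight-step : ∀ {a c b} (e : adj G a c ≡ true) (q : Walk G c b) →
    Tight (step a e q) → d c ≡ suc (d a) × Tight q
  tight-step {a} {c} {b} e q tight = dc , ≤-antisym (d-walk q) (≤-reflexive db)
    where
    db′ : d b ≡ suc (d a) + len G q
    db′ = trans tight (+-suc (d a) (len G q))
    dc : d c ≡ suc (d a)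
    dc = ≤-antisym (d-adj e)
      (+-cancelʳ-≤ (len G q) (suc (d a)) (d c) (subst (_≤ d c + len G q) db′ (d-walk q)))
    db : d c + len G q ≡ d b
    db = trans (cong (_+ len G q) dc) (sym db′)

  tight⇒start-nearest : ∀ {a b} (p : Walk G a b) → Tight p → All (λ z → d a ≤ d z) (verts G p)
  tight⇒start-nearest (stop a)     _     = ≤-refl ∷ []
  tight⇒start-nearest (step a e q) tight with tight-step e q tight
  ... | dc , tight-q =
    ≤-refl ∷ All.map (λ c≤z → ≤-trans (n≤1+n _) (subst (_≤ _) dc c≤z)) (tight⇒start-nearest q tight-q)

  tight⇒unique : ∀ {a b} (p : Walk G a b) → Tight p → Unique (verts G p)
  tight⇒unique (stop a)     _     = [] ∷ []
  tight⇒unique (step a e q) tight with tight-step e q tight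
  ... | dc , tight-q =
    All.map (λ c≤z a≡z → <-irrefl (cong d a≡z) (subst (_≤ _) dc c≤z)) (tight⇒start-nearest q tight-q)
    ∷ tight⇒unique q tight-q

  shortest⇒tight : ∀ {v} (p : Walk G r v) → (∀ q → len G p ≤ len G q) → Tight p
  shortest⇒tight {v} p minimal = trans (≤-antisym (d≤len p) p≤d) (cong (_+ len G p) (sym d-root))
    where
    p≤d : len G p ≤ d v
    p≤d = subst (len G p ≤_) (proj₂ (shortest-walk v)) (minimal (proj₁ (shortest-walk v)))

isLeaf : ∀ {N} → Graph N → Fin N → Fin N → Bool
isLeaf T r u = not ⌊ r ≟ u ⌋ ∧ (deg T u ≡ᵇ 1)

leafSet : ∀ {N} → Graph N → Fin N → Subset N
leafSet T r = tabulate (isLeaf T r)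

∣leafSet∣≡leavesFrom : ∀ {N} (T : Graph N) r → ∣ leafSet T r ∣ ≡ leavesFrom T r
∣leafSet∣≡leavesFrom T r = sym (length-filterᵇ-tabulate (isLeaf T r) id)

module _ {N} (T : Graph N) (r : Fin N) where

  leaf⁺ : ∀ {u} → u ≢ r → deg T u ≡ 1 → u ∈ leafSet T r
  leaf⁺ {u} u≢r deg≡1 = ∈-tabulate⁺ _
    (cong₂ (λ b k → not b ∧ (k ≡ᵇ 1)) (trans (isYes≗does _) (dec-false (r ≟ u) (u≢r ∘ sym))) deg≡1)

  leaf⇒≢root : ∀ {u} → u ∈ leafSet T r → u ≢ r
  leaf⇒≢root {u} u∈L u≡r = case not-true≡true of λ ()
    where
    not-true≡true : not true ≡ true
    not-true≡true = subst (λ b → not b ≡ true) (trans (isYes≗does _) (dec-true (r ≟ u) (sym u≡r)))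
      (∧-conicalˡ _ _ (∈-tabulate⁻ _ u∈L))

  leaf⇒deg≡1 : ∀ {u} → u ∈ leafSet T r → deg T u ≡ 1
  leaf⇒deg≡1 {u} u∈L = ≡ᵇ⇒≡ (deg T u) 1 (Equivalence.from T-≡ (∧-conicalʳ _ _ (∈-tabulate⁻ _ u∈L)))

  inner-vertex⇒non-leaf : ∀ {a b} (p : Walk T a b) → Unique (verts T p) →
    ∀ {z} → z ∈ₗ verts T p → z ≢ a → z ≢ b → z ∉ leafSet T r
  inner-vertex⇒non-leaf p unique z∈p z≢a z≢b z∈L =
    case subst (2 ≤_) (leaf⇒deg≡1 z∈L) (inner-vertex⇒2≤deg T p unique z∈p z≢a z≢b) of λ where
      (s≤s ())

module _ {N} (G : Graph N) (connected : Connected G) {x T} (spt : IsShortestPathTree G x T) where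

  open Distance G connected x using (tight⇒unique; shortest⇒tight)

  leafSet-visible : IsVisibilitySet G x (leafSet T x)
  leafSet-visible = (λ x∈L → leaf⇒≢root T x x∈L refl) , visible
    where
    visible : ∀ y → y ∈ leafSet T x → Σ (Walk G x y) λ p →
      IsShortest G p × (∀ z → z ∈ₗ verts G p → z ∈ leafSet T x → z ≡ y)
    visible y _ with proj₂ (proj₂ spt) y
    ... | k , ((pT , len≡k) , _) , (_ , k≤len) = p , (unique-p , minimal) , only-y
      where
      T⊆G : SpanningSubgraph T G
      T⊆G = proj₁ spt
      p : Walk G x y
      p = liftWalk T⊆G pT
      minimal : ∀ q → len G p ≤ len G q
      minimal q = subst (_≤ len G q) (sym (trans (len-liftWalk T⊆G pT) len≡k)) (k≤len q)
      unique-p : Unique (verts G p)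
      unique-p = tight⇒unique p (shortest⇒tight p minimal)
      only-y : ∀ z → z ∈ₗ verts G p → z ∈ leafSet T x → z ≡ y
      only-y z z∈p z∈L with z ≟ y | z ≟ x
      ... | yes z≡y | _       = z≡y
      ... | no _    | yes z≡x = ⊥-elim (leaf⇒≢root T x z∈L z≡x)
      ... | no z≢y  | no z≢x  = ⊥-elim (inner-vertex⇒non-leaf T x pT
        (subst Unique (verts-liftWalk T⊆G pT) unique-p) (subst (z ∈ₗ_) (verts-liftWalk T⊆G pT) z∈p)
        z≢x z≢y z∈L)

module ParentTree {N} (G : Graph N) (connected : Connected G) (r : Fin N)
  (par : Fin N → Fin N) (par-root : par r ≡ r)
  (par-adj : ∀ {v} → v ≢ r → adj G v (par v) ≡ true)
  (par-d : ∀ {v} → v ≢ r → suc (Distance.d G connected r (par v)) ≡ Distance.d G connected r v) where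

  open Distance G connected r

  ParentEdge : Fin N → Fin N → Set
  ParentEdge u v = u ≢ r × par u ≡ v

  parentEdge? : ∀ u v → Dec (ParentEdge u v)
  parentEdge? u v = ¬? (u ≟ r) ×-dec (par u ≟ v)

  TreeEdge : Fin N → Fin N → Set
  TreeEdge u v = ParentEdge u v ⊎ ParentEdge v u

  treeEdge? : ∀ u v → Dec (TreeEdge u v)
  treeEdge? u v = parentEdge? u v ⊎-dec parentEdge? v u

  parentEdge-d : ∀ {u v} → ParentEdge u v → suc (d v) ≡ d u
  parentEdge-d (u≢r , refl) = par-d u≢r

  parentEdge-irrefl : ∀ {u} → ¬ ParentEdge u u
  parentEdge-irrefl pe = <-irrefl (sym (parentEdge-d pe)) (n<1+n _)

  T : Graph N
  T = record
    { adj    = λ u v → does (treeEdge? u v)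
    ; sym    = λ u v → ∨-comm (does (parentEdge? u v)) (does (parentEdge? v u))
    ; irrefl = λ u → dec-false (treeEdge? u u) [ parentEdge-irrefl , parentEdge-irrefl ]
    }

  T-edge : ∀ {u v} → adj T u v ≡ true → TreeEdge u v
  T-edge {u} {v} = does≡true⇒ (treeEdge? u v)

  T-par : ∀ {v} → v ≢ r → adj T v (par v) ≡ true
  T-par {v} v≢r = dec-true (treeEdge? v (par v)) (inj₁ (v≢r , refl))

  T⊆G : SpanningSubgraph T G
  T⊆G u v uv with T-edge {u} {v} uv
  ... | inj₁ (u≢r , refl) = par-adj u≢r
  ... | inj₂ (v≢r , refl) = trans (Graph.sym G u v) (par-adj v≢r)

  toRoot : ∀ k {v} → d v ≡ k → Σ (Walk T v r) λ p → len T p ≡ k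
  toRoot zero {v} d≡0 rewrite d≡0⇒root d≡0 = stop r , refl
  toRoot (suc k) {v} d≡1+k with v ≟ r
  ... | yes refl = case trans (sym d-root) d≡1+k of λ ()
  ... | no v≢r with toRoot k (suc-injective (trans (par-d v≢r) d≡1+k))
  ...   | p , len≡k = step v (T-par v≢r) p , cong suc len≡k

  T-connected : Connected T
  T-connected u v = proj₁ (toRoot (d u) refl) ++ reverse (proj₁ (toRoot (d v) refl))

  private
    secondLast : Fin N → List (Fin N) → Fin N
    secondLast a []           = a
    secondLast a (_ ∷ [])     = a
    secondLast a (b ∷ c ∷ cs) = secondLast b (c ∷ cs)

    secondLast∈ : ∀ b c cs → secondLast b (c ∷ cs) ∈ₗ b ∷ c ∷ cs
    secondLast∈ b c []        = here refl
    secondLast∈ b c (c′ ∷ cs) = there (secondLast∈ c c′ cs)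

    lastOf∈ : ∀ u vs → lastOf T u vs ∈ₗ u ∷ vs
    lastOf∈ u []       = here refl
    lastOf∈ u (w ∷ vs) = there (lastOf∈ w vs)

    parentEdge⇒< : ∀ {u v} → ParentEdge u v → d v < d u
    parentEdge⇒< = ≤-reflexive ∘ parentEdge-d

  -- Along a T-path, once a step goes from a vertex to a child, so does every later step:
  -- the child's only parent is the vertex just left.
  downward⇒deeper-end : ∀ {a b} ws → ChainFrom T b (b ∷ ws) → Unique (a ∷ b ∷ ws) →
    ParentEdge b a → d a < d (lastOf T b ws)
  downward⇒deeper-end []       _               _                       b→a = parentEdge⇒< b→a
  downward⇒deeper-end (c ∷ ws) (more _ bc chain) ((_ ∷ a≢c ∷ _) ∷ unique) b→a with T-edge bc
  ... | inj₁ b→c = ⊥-elim (a≢c (trans (sym (proj₂ b→a)) (proj₂ b→c)))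
  ... | inj₂ c→b = <-trans (parentEdge⇒< b→a) (downward⇒deeper-end ws chain unique c→b)

  downward-end⊎upward : ∀ {a b} ws → adj T a b ≡ true → ChainFrom T b (b ∷ ws) →
    Unique (a ∷ b ∷ ws) → ParentEdge (lastOf T b ws) (secondLast a (b ∷ ws)) ⊎ (ParentEdge a b × d (lastOf T b ws) < d a)
  downward-end⊎upward [] ab _ _ with T-edge ab
  ... | inj₁ a→b = inj₂ (a→b , parentEdge⇒< a→b)
  ... | inj₂ b→a = inj₁ b→a
  downward-end⊎upward (c ∷ ws) ab (more _ bc chain) ((_ ∷ a≢c ∷ _) ∷ unique)
    with downward-end⊎upward ws bc chain unique
  ... | inj₁ downward-end = inj₁ downward-end
  ... | inj₂ (b→c , end<b) with T-edge ab
  ...   | inj₁ a→b = inj₂ (a→b , <-trans end<b (parentEdge⇒< a→b))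
  ...   | inj₂ b→a = ⊥-elim (a≢c (trans (sym (proj₂ b→a)) (proj₂ b→c)))

  T-acyclic : Acyclic T
  T-acyclic []               ()
  T-acyclic (_ ∷ [])         ()
  T-acyclic (_ ∷ _ ∷ [])     ()
  T-acyclic (v ∷ w ∷ u ∷ vs) (unique , more _ vw chain , closing) with T-edge closing | unique
  ... | inj₁ end→v | v∉ ∷ _ with downward-end⊎upward (u ∷ vs) vw chain unique
  ...   | inj₁ end→secondLast =
    All.lookup v∉ (secondLast∈ w u vs) (trans (sym (proj₂ end→v)) (proj₂ end→secondLast))
  ...   | inj₂ (_ , end<v)    = <-asym end<v (parentEdge⇒< end→v)
  T-acyclic (v ∷ w ∷ u ∷ vs) (unique , more _ vw chain , closing) | inj₂ v→end | _ ∷ w∉ ∷ _ with T-edge vw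
  ... | inj₁ v→w = All.lookup w∉ (lastOf∈ u vs) (trans (sym (proj₂ v→w)) (proj₂ v→end))
  ... | inj₂ w→v = <-asym (downward⇒deeper-end (u ∷ vs) chain unique w→v) (parentEdge⇒< v→end)

  T-spt : IsShortestPathTree G r T
  T-spt = T⊆G , (T-connected , T-acyclic) , λ y → d y , distT y , isDist y
    where
    distT : ∀ y → IsDist T r y (d y)
    distT y with toRoot (d y) refl
    ... | p , len≡d = (reverse p , trans (len-reverse p) len≡d) ,
                      λ q → subst (d y ≤_) (len-liftWalk T⊆G q) (d≤len (liftWalk T⊆G q))

  Childless : Fin N → Set
  Childless v = ∀ u → ¬ ParentEdge u v

  childless⇒leaf : ∀ {w} → w ≢ r → Childless w → w ∈ leafSet T r
  childless⇒leaf {w} w≢r childless = leaf⁺ T r w≢r (unique-neighbour⇒deg≡1 T (T-par w≢r) only-parent)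
    where
    only-parent : ∀ u → adj T w u ≡ true → u ≡ par w
    only-parent u wu with T-edge {w} {u} wu
    ... | inj₁ (_ , par-w≡u) = sym par-w≡u
    ... | inj₂ u→w           = ⊥-elim (childless u u→w)

  ancestor : ℕ → Fin N → Fin N
  ancestor k v = fold v par k

  ancestor-root : ∀ k → ancestor k r ≡ r
  ancestor-root zero    = refl
  ancestor-root (suc k) = trans (cong par (ancestor-root k)) par-root

  d-ancestor : ∀ k {v} → k ≤ d v → d (ancestor k v) + k ≡ d v
  d-ancestor zero    {v} _   = +-identityʳ (d v)
  d-ancestor (suc k) {v} k<d = begin
    d (par a) + suc k    ≡⟨ +-suc (d (par a)) k ⟩
    suc (d (par a)) + k  ≡⟨ cong (_+ k) (par-d a≢r) ⟩
    d a + k              ≡⟨ d-ancestor k (<⇒≤ k<d) ⟩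
    d v                  ∎
    where
    open ≡-Reasoning
    a : Fin N
    a = ancestor k v
    a≢r : a ≢ r
    a≢r a≡r = <-irrefl (trans (sym (cong (_+ k) (trans (cong d a≡r) d-root))) (d-ancestor k (<⇒≤ k<d))) k<d

  ancestor-injective : ∀ {v i j} → i ≤ d v → j ≤ d v → ancestor i v ≡ ancestor j v → i ≡ j
  ancestor-injective {v} {i} {j} i≤d j≤d same = +-cancelˡ-≡ (d (ancestor j v)) i j (begin
    d (ancestor j v) + i  ≡⟨ cong (λ a → d a + i) same ⟨
    d (ancestor i v) + i  ≡⟨ d-ancestor i i≤d ⟩
    d v                   ≡⟨ d-ancestor j j≤d ⟨
    d (ancestor j v) + j  ∎)
    where open ≡-Reasoning

  d<N : ∀ v → d v < N
  d<N v = ≰⇒> λ N≤d → case pigeonhole (n<1+n N) (λ i → ancestor (toℕ i) v) of λ where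
    (i , j , i<j , same) →
      <-irrefl (ancestor-injective (≤-trans (toℕ≤pred[n] i) N≤d) (≤-trans (toℕ≤pred[n] j) N≤d) same) i<j

  ancestor-∸ : ∀ {i j} w → i ≤ j → ancestor (j ∸ i) (ancestor i w) ≡ ancestor j w
  ancestor-∸ {i} {j} w i≤j = trans (sym (fold-+ w par (j ∸ i))) (cong (λ k → ancestor k w) (m∸n+n≡m i≤j))

  ancestors-comparable : ∀ i j w →
    (∃ λ m → ancestor m (ancestor i w) ≡ ancestor j w) ⊎ (∃ λ m → ancestor m (ancestor j w) ≡ ancestor i w)
  ancestors-comparable i j w with ≤-total i j
  ... | inj₁ i≤j = inj₁ (j ∸ i , ancestor-∸ w i≤j)
  ... | inj₂ j≤i = inj₂ (i ∸ j , ancestor-∸ w j≤i)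

  childless-descendant : ∀ v → ∃ λ w → Childless w × ∃ λ i → ancestor i w ≡ v
  childless-descendant v = go N (m≤n+m N (d v))
    where
    go : ∀ k {v} → N ≤ d v + k → ∃ λ w → Childless w × ∃ λ i → ancestor i w ≡ v
    go zero    {v} N≤d = ⊥-elim (≤⇒≯ (subst (N ≤_) (+-identityʳ (d v)) N≤d) (d<N v))
    go (suc k) {v} N≤d with any? (λ u → parentEdge? u v)
    ... | no none = v , (λ u u→v → none (u , u→v)) , 0 , refl
    ... | yes (u , u→v) with go k (subst (N ≤_) (trans (+-suc (d v) k) (cong (_+ k) (parentEdge-d u→v))) N≤d)
    ...   | w , childless , i , ancestor≡u = w , childless , suc i , trans (cong par ancestor≡u) (proj₂ u→v)

module AvoidingTree {N} (G : Graph N) (connected : Connected G) (r : Fin N) (S : Subset N) where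

  open Distance G connected r

  ClearStep : Fin N → Fin N → Set
  ClearStep v u = adj G v u ≡ true × suc (d u) ≡ d v × u ∉ S

  clearStep? : ∀ v u → Dec (ClearStep v u)
  clearStep? v u = (adj G v u Bool.≟ true) ×-dec (suc (d u) ℕ.≟ d v) ×-dec ¬? (u ∈? S)

  -- Clear j v: some geodesic with j edges joins v to r, and v is its only vertex that may lie in S.
  Clear : ℕ → Fin N → Set
  Clear zero    v = v ≡ r
  Clear (suc j) v = ∃ λ u → ClearStep v u × Clear j u

  clear? : ∀ j v → Dec (Clear j v)
  clear? zero    v = v ≟ r
  clear? (suc j) v = any? λ u → clearStep? v u ×-dec clear? j u

  IsClear : Fin N → Set
  IsClear v = Clear (d v) v

  ClearParent : Fin N → Fin N → Set
  ClearParent v u = ClearStep v u × IsClear u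

  clearParent? : ∀ v → Dec (∃ (ClearParent v))
  clearParent? v = any? λ u → clearStep? v u ×-dec clear? (d u) u

  clear-root : IsClear r
  clear-root = subst (λ j → Clear j r) (sym d-root) refl

  clearParent⇒clear : ∀ {v u} → ClearParent v u → IsClear v
  clearParent⇒clear {v} (vu@(_ , du , _) , clear-u) = subst (λ j → Clear j v) du (_ , vu , clear-u)

  clear⇒clearParent : ∀ {v} → v ≢ r → IsClear v → ∃ (ClearParent v)
  clear⇒clearParent {v} v≢r = go (d v) refl
    where
    go : ∀ j → j ≡ d v → Clear j v → ∃ (ClearParent v)
    go zero    _   v≡r                             = ⊥-elim (v≢r v≡r)
    go (suc j) j≡d (u , vu@(_ , du , _) , clear-u) =
      u , vu , subst (λ k → Clear k u) (suc-injective (trans j≡d (sym du))) clear-u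

  root-has-no-clearParent : ∀ {u} → ¬ ClearParent r u
  root-has-no-clearParent ((_ , du , _) , _) = case trans du d-root of λ ()

  par : Fin N → Fin N
  par v with v ≟ r | clearParent? v
  ... | yes _   | _           = r
  ... | no _    | yes (u , _) = u
  ... | no v≢r  | no _        = proj₁ (parent v≢r)

  par-root : par r ≡ r
  par-root with r ≟ r
  ... | yes _  = refl
  ... | no r≢r = ⊥-elim (r≢r refl)

  par-step : ∀ {v} → v ≢ r → adj G v (par v) ≡ true × suc (d (par v)) ≡ d v
  par-step {v} v≢r with v ≟ r | clearParent? v
  ... | yes v≡r | _                             = ⊥-elim (v≢r v≡r)
  ... | no _    | yes (_ , (vu , du , _) , _)   = vu , du
  ... | no v≢r′ | no _                          = proj₂ (parent v≢r′)

  par-clearParent : ∀ {v} → ∃ (ClearParent v) → ClearParent v (par v)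
  par-clearParent {v} (u , cp) with v ≟ r | clearParent? v
  ... | yes refl | _             = ⊥-elim (root-has-no-clearParent cp)
  ... | no _     | yes (_ , cp′) = cp′
  ... | no _     | no none       = ⊥-elim (none (u , cp))

  open ParentTree G connected r par par-root (proj₁ ∘ par-step) (proj₂ ∘ par-step) public

  clear-par : r ∉ S → ∀ {v} → IsClear v → IsClear (par v) × par v ∉ S
  clear-par r∉S {v} clear-v = by-cases (v ≟ r)
    where
    by-cases : Dec (v ≡ r) → IsClear (par v) × par v ∉ S
    by-cases (yes v≡r) =
      subst (λ u → IsClear u × u ∉ S) (sym (trans (cong par v≡r) par-root)) (clear-root , r∉S)
    by-cases (no v≢r) with par-clearParent (clear⇒clearParent v≢r clear-v)
    ... | (_ , _ , par-v∉S) , clear-par-v = clear-par-v , par-v∉S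

  clear-ancestor : r ∉ S → ∀ {v} → IsClear v → ∀ k → IsClear (ancestor k v)
  clear-ancestor r∉S clear-v zero    = clear-v
  clear-ancestor r∉S clear-v (suc k) = proj₁ (clear-par r∉S (clear-ancestor r∉S clear-v k))

  tight-walk⇒clear : ∀ {a b} (p : Walk G a b) → Tight p → IsClear a → a ∉ S →
    (∀ z → z ∈ₗ verts G p → z ∈ S → z ≡ b) → IsClear b
  tight-walk⇒clear (stop a) _ clear-a _ _ = clear-a
  tight-walk⇒clear (step {c} a e q) tight clear-a a∉S only-b with tight-step e q tight
  ... | dc , tight-q = continue (c ∈? S)
    where
    clear-c : IsClear c
    clear-c = clearParent⇒clear ((trans (Graph.sym G c a) e , sym dc , a∉S) , clear-a)
    continue : Dec (c ∈ S) → IsClear _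
    continue (yes c∈S) = subst IsClear (only-b c (there (head∈verts q)) c∈S) clear-c
    continue (no c∉S)  = tight-walk⇒clear q tight-q clear-c c∉S (λ z → only-b z ∘ there)

  module _ (visible : IsVisibilitySet G r S) where

    private
      r∉S : r ∉ S
      r∉S = proj₁ visible

      ∈S⇒≢r : ∀ {y} → y ∈ S → y ≢ r
      ∈S⇒≢r y∈S refl = r∉S y∈S

    visible⇒clear : ∀ {y} → y ∈ S → IsClear y
    visible⇒clear {y} y∈S with proj₂ visible y y∈S
    ... | p , (_ , minimal) , only-y = tight-walk⇒clear p (shortest⇒tight p minimal) clear-root r∉S only-y

    ancestor∈S⇒≡ : ∀ {y z} → y ∈ S → z ∈ S → ∀ m → ancestor m y ≡ z → y ≡ z
    ancestor∈S⇒≡ _   _   zero    y≡z   = y≡z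
    ancestor∈S⇒≡ y∈S z∈S (suc m) refl =
      ⊥-elim (proj₂ (clear-par r∉S (clear-ancestor r∉S (visible⇒clear y∈S) m)) z∈S)

    leafBelow : Fin N → Fin N
    leafBelow y = proj₁ (childless-descendant y)

    leafBelow-leaf : ∀ {y} → y ∈ S → leafBelow y ∈ leafSet T r
    leafBelow-leaf {y} y∈S with childless-descendant y
    ... | w , childless , i , ancestor≡y = childless⇒leaf w≢r childless
      where
      w≢r : w ≢ r
      w≢r refl = ∈S⇒≢r y∈S (trans (sym ancestor≡y) (ancestor-root i))

    leafBelow-injective : ∀ {y z} → y ∈ S → z ∈ S → leafBelow y ≡ leafBelow z → y ≡ z
    leafBelow-injective {y} {z} y∈S z∈S same with childless-descendant y | childless-descendant z
    ... | w , _ , i , ancestor≡y | _ , _ , j , ancestor≡z rewrite sym same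
      with ancestors-comparable i j w
    ...   | inj₁ (m , above) = ancestor∈S⇒≡ y∈S z∈S m
                                 (subst₂ (λ a b → ancestor m a ≡ b) ancestor≡y ancestor≡z above)
    ...   | inj₂ (m , above) = sym (ancestor∈S⇒≡ z∈S y∈S m
                                 (subst₂ (λ a b → ancestor m a ≡ b) ancestor≡z ancestor≡y above))

    visible⇒∣S∣≤leaves : ∣ S ∣ ≤ leavesFrom T r
    visible⇒∣S∣≤leaves = subst (∣ S ∣ ≤_) (∣leafSet∣≡leavesFrom T r)
      (injectiveOn⇒∣p∣≤∣q∣ leafBelow leafBelow-leaf leafBelow-injective)

leavesFrom≤N : ∀ {N} (T : Graph N) r → leavesFrom T r ≤ N
leavesFrom≤N T r = subst (_≤ _) (∣leafSet∣≡leavesFrom T r) (∣p∣≤n (leafSet T r))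

module _ {n} (G : Graph (suc n)) (connected : Connected G) where

  avoidingLeaves : Fin (suc n) × Subset (suc n) → ℕ
  avoidingLeaves (x , S) = leavesFrom (AvoidingTree.T G connected x S) x

  avoidingLeaves-maximum : ∃ λ xS → ∀ yS → avoidingLeaves yS ≤ avoidingLeaves xS
  avoidingLeaves-maximum = maximum-attained avoidingLeaves
    (λ m → map′ (λ (x , S , m≤) → (x , S) , m≤) (λ ((x , S) , m≤) → x , S , m≤)
                (any? λ x → anySubset? λ S → m ≤? avoidingLeaves (x , S)))
    (λ (x , S) → leavesFrom≤N (AvoidingTree.T G connected x S) x) (zero , ⊥)

  -- The implicit arguments below are passed explicitly: unifying through avoidingLeaves
  -- would make Agda evaluate leaf counts of concrete trees.
  visible⇒∣S∣≤avoidingLeaves : ∀ {x S} → IsVisibilitySet G x S → ∣ S ∣ ≤ avoidingLeaves (x , S)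
  visible⇒∣S∣≤avoidingLeaves {x} {S} = AvoidingTree.visible⇒∣S∣≤leaves G connected x S

  spt⇒leaves≤avoidingLeaves : ∀ {x T} → IsShortestPathTree G x T →
    leavesFrom T x ≤ avoidingLeaves (x , leafSet T x)
  spt⇒leaves≤avoidingLeaves {x} {T} spt =
    subst (_≤ avoidingLeaves (x , leafSet T x)) (∣leafSet∣≡leavesFrom T x)
    (visible⇒∣S∣≤avoidingLeaves {x} {leafSet T x} (leafSet-visible G connected spt))

  module _ (best : Fin (suc n) × Subset (suc n))
           (maximal : ∀ xS → avoidingLeaves xS ≤ avoidingLeaves best) where

    private
      x : Fin (suc n)
      x = proj₁ best

      T : Graph (suc n)
      T = AvoidingTree.T G connected x (proj₂ best)

      T-spt : IsShortestPathTree G x T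
      T-spt = AvoidingTree.T-spt G connected x (proj₂ best)

    maximal⇒IsVV : IsVV G (avoidingLeaves best)
    maximal⇒IsVV =
      (x , leafSet T x , leafSet-visible G connected T-spt , ∣leafSet∣≡leavesFrom T x) ,
      λ y S visible → ≤-trans (visible⇒∣S∣≤avoidingLeaves {y} {S} visible) (maximal (y , S))

    maximal⇒IsMaxSPTLeaves : IsMaxSPTLeaves G (avoidingLeaves best)
    maximal⇒IsMaxSPTLeaves =
      (x , T , T-spt , refl) ,
      λ y T′ spt → ≤-trans (spt⇒leaves≤avoidingLeaves {y} {T′} spt) (maximal (y , leafSet T′ y))

theorem2p2 : ∀ (n : ℕ) (G : Graph (suc n)) → Connected G →
    ∃ λ k → IsVV G k × IsMaxSPTLeaves G k
theorem2p2 n G connected = avoidingLeaves G connected best ,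
  maximal⇒IsVV G connected best maximal , maximal⇒IsMaxSPTLeaves G connected best maximal
  where
  best : Fin (suc n) × Subset (suc n)
  best = proj₁ (avoidingLeaves-maximum G connected)
  maximal : ∀ xS → avoidingLeaves G connected xS ≤ avoidingLeaves G connected best
  maximal = proj₂ (avoidingLeaves-maximum G connected)
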